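{- Let $\mathbf{T}=(T,\eta,\mu)$ be a monad on $\mathbf{Set}$ and let $F\colon \mathbf{Set}\to\mathbf{Set}$ be an endofunctor which has a final coalgebra and which has a $\mathbf{T}$-algebra lifting $F^*$. Assume moreover that the functor $FT$ has a final coalgebra (so that $\sim_{FT}$ is defined). Then for all $FT$-coalgebras $(X,f)$, $(Y,g)$ and all states $x\in X$, $y\in Y$: if $x\sim_{FT} y$ then $x\approx_F^T y$.
   Context: For a functor $G\colon\mathbf{Set}\to\mathbf{Set}$, a $G$-coalgebra is a pair $(X,f\colon X\to G(X))$; a $G$-homomorphism $h\colon (X,f)\to(Y,g)$ is a function with $g\circ h=G(h)\circ f$. A $G$-coalgebra $(\Omega,\omega)$ is final if every $G$-coalgebra $(X,f)$ has a unique homomorphism $[\![-]\!]_X\colon X\to\Omega$. When $G$ has a final coalgebra, states $x\in X$, $y\in Y$ of $G$-coalgebras $(X,f)$, $(Y,g)$ are behaviourally equivalent, written $x\sim_G y$, iff $[\![x]\!]_X=[\![y]\!]_Y$. A $\mathbf{T}$-algebra is a pair $(A,h\colon T(A)\to A)$ with $h\circ\mu_A=h\circ T(h)$ and $h\circ\eta_A=\mathrm{id}_A$; these with $\mathbf{T}$-homomorphisms form the Eilenberg–Moore category $\mathbf{Set}^{\mathbf{T}}$ with forgetful functor $U^{\mathbf{T}}\colon\mathbf{Set}^{\mathbf{T}}\to\mathbf{Set}$. A $\mathbf{T}$-algebra lifting of $F$ is an endofunctor $F^*\colon\mathbf{Set}^{\mathbf{T}}\to\mathbf{Set}^{\mathbf{T}}$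 with $U^{\mathbf{T}}\circ F^*=F\circ U^{\mathbf{T}}$. In that case, for each set $X$, $F^*(T(X),\mu_X)$ is a $\mathbf{T}$-algebra of the form $(FT(X),h_X)$. Given an $FT$-coalgebra $(X,f\colon X\to FT(X))$, let $f^\sharp=h_X\circ T(f)\colon T(X)\to FT(X)$ be the unique $\mathbf{T}$-algebra homomorphism $(T(X),\mu_X)\to(FT(X),h_X)$ with $f^\sharp\circ\eta_X=f$; thus $(T(X),f^\sharp)$ is an $F$-coalgebra. For $FT$-coalgebras $(X,f)$, $(Y,g)$ and $x\in X$, $y\in Y$, define $x\approx_F^T y$ iff $\eta_X(x)\sim_F\eta_Y(y)$, where $\sim_F$ is behavioural equivalence between the $F$-coalgebras $(T(X),f^\sharp)$ and $(T(Y),g^\sharp)$. -}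

module Defs where

open import Function using (_∘_; id)
open import Relation.Binary.PropositionalEquality using (_≡_)

-- Endofunctors on Set (Agda's Set₀). Morphisms of Set are compared
-- pointwise (no function extensionality), so functor laws are pointwise
-- and fmap must respect pointwise equality of functions.
record Functor : Set₁ where
  field
    F₀       : Set → Set
    fmap     : ∀ {A B : Set} → (A → B) → F₀ A → F₀ B
    fmap-id  : ∀ {A : Set} (t : F₀ A) → fmap id t ≡ t
    fmap-∘   : ∀ {A B C : Set} (g : B → C) (h : A → B) (t : F₀ A) →
               fmap (g ∘ h) t ≡ fmap g (fmap h t)
    fmap-cong : ∀ {A B : Set} {g h : A → B} → (∀ a → g a ≡ h a) →
                (t : F₀ A) → fmap g t ≡ fmap h t

open Functor public

_⊚_ : Functor → Functor → Functor
G ⊚ H = record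
  { F₀ = λ A → F₀ G (F₀ H A)
  ; fmap = λ k → fmap G (fmap H k)
  ; fmap-id = λ t → Relation.Binary.PropositionalEquality.trans
      (fmap-cong G (fmap-id H) t) (fmap-id G t)
  ; fmap-∘ = λ g h t → Relation.Binary.PropositionalEquality.trans
      (fmap-cong G (fmap-∘ H g h) t) (fmap-∘ G (fmap H g) (fmap H h) t)
  ; fmap-cong = λ e t → fmap-cong G (fmap-cong H e) t
  }

record Monad : Set₁ where
  field
    T      : Functor
    η      : ∀ {A : Set} → A → F₀ T A
    μ      : ∀ {A : Set} → F₀ T (F₀ T A) → F₀ T A
    η-nat  : ∀ {A B : Set} (k : A → B) (a : A) → η (k a) ≡ fmap T k (η a)
    μ-nat  : ∀ {A B : Set} (k : A → B) (t : F₀ T (F₀ T A)) →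
             μ (fmap T (fmap T k) t) ≡ fmap T k (μ t)
    μ-assoc : ∀ {A : Set} (t : F₀ T (F₀ T (F₀ T A))) → μ (μ t) ≡ μ (fmap T μ t)
    μ-η    : ∀ {A : Set} (t : F₀ T A) → μ (η t) ≡ t
    μ-Tη   : ∀ {A : Set} (t : F₀ T A) → μ (fmap T η t) ≡ t

open Monad public

module _ (𝕋 : Monad) where
  private
    TT = T 𝕋

  record IsAlgebra (A : Set) (a : F₀ TT A → A) : Set where
    field
      alg-assoc : ∀ (t : F₀ TT (F₀ TT A)) → a (μ 𝕋 t) ≡ a (fmap TT a t)
      alg-unit  : ∀ (x : A) → a (η 𝕋 x) ≡ x

  record Algebra : Set₁ where
    constructor mkAlg
    field
      Carrier : Set
      str     : F₀ TT Carrier → Carrier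
      isAlg   : IsAlgebra Carrier str

  open Algebra public

  IsAlgHom : (𝔸 𝔹 : Algebra) → (Carrier 𝔸 → Carrier 𝔹) → Set
  IsAlgHom 𝔸 𝔹 k = ∀ (t : F₀ TT (Carrier 𝔸)) → k (str 𝔸 t) ≡ str 𝔹 (fmap TT k t)

  freeAlg : Set → Algebra
  freeAlg X = mkAlg (F₀ TT X) (μ 𝕋) record { alg-assoc = μ-assoc 𝕋 ; alg-unit = μ-η 𝕋 }

  -- A T-algebra lifting F* of F: an endofunctor of Set^T with U ∘ F* = F ∘ U.
  -- On objects, F* sends (A, a) to an algebra with carrier F A; on morphisms,
  -- F* k has underlying function F k (which must therefore be a T-algebra
  -- homomorphism). Functor laws of F* are inherited from F since U is faithful.
  record Lifting (F : Functor) : Set₁ where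
    field
      lift     : (𝔸 : Algebra) → F₀ TT (F₀ F (Carrier 𝔸)) → F₀ F (Carrier 𝔸)
      lift-alg : (𝔸 : Algebra) → IsAlgebra (F₀ F (Carrier 𝔸)) (lift 𝔸)

    F* : Algebra → Algebra
    F* 𝔸 = mkAlg (F₀ F (Carrier 𝔸)) (lift 𝔸) (lift-alg 𝔸)

    field
      lift-hom : (𝔸 𝔹 : Algebra) (k : Carrier 𝔸 → Carrier 𝔹) →
                 IsAlgHom 𝔸 𝔹 k → IsAlgHom (F* 𝔸) (F* 𝔹) (fmap F k)

  open Lifting public

record Coalgebra (G : Functor) : Set₁ where
  constructor mkCoalg
  field
    State : Set
    next  : State → F₀ G State

open Coalgebra public

IsCoalgHom : (G : Functor) (𝕏 𝕐 : Coalgebra G) → (State 𝕏 → State 𝕐) → Set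
IsCoalgHom G 𝕏 𝕐 h = ∀ (x : State 𝕏) → next 𝕐 (h x) ≡ fmap G h (next 𝕏 x)

record FinalCoalgebra (G : Functor) : Set₁ where
  field
    Ω      : Coalgebra G
    ⟦_⟧    : (𝕏 : Coalgebra G) → State 𝕏 → State Ω
    ⟦⟧-hom : (𝕏 : Coalgebra G) → IsCoalgHom G 𝕏 Ω (⟦ 𝕏 ⟧)
    ⟦⟧-unique : (𝕏 : Coalgebra G) (h : State 𝕏 → State Ω) →
                IsCoalgHom G 𝕏 Ω h → ∀ (x : State 𝕏) → h x ≡ ⟦ 𝕏 ⟧ x

open FinalCoalgebra public

Beh : {G : Functor} (fin : FinalCoalgebra G) (𝕏 𝕐 : Coalgebra G) →
      State 𝕏 → State 𝕐 → Set
Beh fin 𝕏 𝕐 x y = ⟦ fin ⟧ 𝕏 x ≡ ⟦ fin ⟧ 𝕐 y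

module _ (𝕋 : Monad) {F : Functor} (L : Lifting 𝕋 F) where
  hLift : (X : Set) → F₀ (T 𝕋) (F₀ F (F₀ (T 𝕋) X)) → F₀ F (F₀ (T 𝕋) X)
  hLift X = lift L (freeAlg 𝕋 X)

  sharp : (𝕏 : Coalgebra (F ⊚ T 𝕋)) → F₀ (T 𝕋) (State 𝕏) → F₀ F (F₀ (T 𝕋) (State 𝕏))
  sharp 𝕏 = hLift (State 𝕏) ∘ fmap (T 𝕋) (next 𝕏)

  determinize : Coalgebra (F ⊚ T 𝕋) → Coalgebra F
  determinize 𝕏 = mkCoalg (F₀ (T 𝕋) (State 𝕏)) (sharp 𝕏)

  BehT : (finF : FinalCoalgebra F) (𝕏 𝕐 : Coalgebra (F ⊚ T 𝕋)) →
         State 𝕏 → State 𝕐 → Set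
  BehT finF 𝕏 𝕐 x y = Beh finF (determinize 𝕏) (determinize 𝕐) (η 𝕋 x) (η 𝕋 y)

-- The unique FT-homomorphism ⟦-⟧ : X → Ω into the final FT-coalgebra is sent
-- by T to an F-homomorphism between the determinizations (T X, f♯) and
-- (T Ω, ω♯), because T⟦-⟧ is a map of free algebras and F* lifts it. By
-- finality of F, η x and T⟦-⟧(η x) = η ⟦x⟧ then have the same F-behaviour,
-- so the F-behaviour of η x depends only on the FT-behaviour ⟦x⟧.
module Submission where

open import Defs
open import Function using (_∘_)
open import Relation.Binary.PropositionalEquality

∘-isCoalgHom : (G : Functor) {𝕏 𝕐 ℤ : Coalgebra G}
               {k : State 𝕐 → State ℤ} {h : State 𝕏 → State 𝕐} →
               IsCoalgHom G 𝕐 ℤ k → IsCoalgHom G 𝕏 𝕐 h →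
               IsCoalgHom G 𝕏 ℤ (k ∘ h)
∘-isCoalgHom G {k = k} {h} k-hom h-hom x =
  trans (k-hom (h x))
        (trans (cong (fmap G k) (h-hom x)) (sym (fmap-∘ G k h _)))

⟦⟧-preserved : {G : Functor} (fin : FinalCoalgebra G) {𝕏 𝕐 : Coalgebra G}
               {h : State 𝕏 → State 𝕐} → IsCoalgHom G 𝕏 𝕐 h →
               ∀ x → ⟦ fin ⟧ 𝕐 (h x) ≡ ⟦ fin ⟧ 𝕏 x
⟦⟧-preserved {G} fin {𝕏} {𝕐} {h} h-hom =
  ⟦⟧-unique fin 𝕏 (⟦ fin ⟧ 𝕐 ∘ h)
    (∘-isCoalgHom G {𝕏} {𝕐} {Ω fin} (⟦⟧-hom fin 𝕐) h-hom)

fmap-isAlgHom-free : (𝕋 : Monad) {X Y : Set} (h : X → Y) →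
                     IsAlgHom 𝕋 (freeAlg 𝕋 X) (freeAlg 𝕋 Y) (fmap (T 𝕋) h)
fmap-isAlgHom-free 𝕋 h t = sym (μ-nat 𝕋 h t)

module _ (𝕋 : Monad) {F : Functor} (L : Lifting 𝕋 F) where
  private
    TT = T 𝕋

  fmap-isCoalgHom-determinize :
    {𝕏 𝕐 : Coalgebra (F ⊚ TT)} {h : State 𝕏 → State 𝕐} →
    IsCoalgHom (F ⊚ TT) 𝕏 𝕐 h →
    IsCoalgHom F (determinize 𝕋 L 𝕏) (determinize 𝕋 L 𝕐) (fmap TT h)
  fmap-isCoalgHom-determinize {𝕏} {𝕐} {h} h-hom t =
    begin
      hLift 𝕋 L (State 𝕐) (fmap TT (next 𝕐) (fmap TT h t))
    ≡⟨ cong (hLift 𝕋 L (State 𝕐)) (sym (fmap-∘ TT (next 𝕐) h t)) ⟩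
      hLift 𝕋 L (State 𝕐) (fmap TT (next 𝕐 ∘ h) t)
    ≡⟨ cong (hLift 𝕋 L (State 𝕐)) (fmap-cong TT h-hom t) ⟩
      hLift 𝕋 L (State 𝕐) (fmap TT (fmap F (fmap TT h) ∘ next 𝕏) t)
    ≡⟨ cong (hLift 𝕋 L (State 𝕐)) (fmap-∘ TT (fmap F (fmap TT h)) (next 𝕏) t) ⟩
      hLift 𝕋 L (State 𝕐) (fmap TT (fmap F (fmap TT h)) (fmap TT (next 𝕏) t))
    ≡⟨ sym (lift-hom L (freeAlg 𝕋 (State 𝕏)) (freeAlg 𝕋 (State 𝕐)) (fmap TT h)
                     (fmap-isAlgHom-free 𝕋 h) (fmap TT (next 𝕏) t)) ⟩
      fmap F (fmap TT h) (sharp 𝕋 L 𝕏 t)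
    ∎
    where open ≡-Reasoning

  ⟦η⟧-factors-through-Ω :
    (finF : FinalCoalgebra F) (finFT : FinalCoalgebra (F ⊚ TT))
    (𝕏 : Coalgebra (F ⊚ TT)) (x : State 𝕏) →
    ⟦ finF ⟧ (determinize 𝕋 L 𝕏) (η 𝕋 x)
      ≡ ⟦ finF ⟧ (determinize 𝕋 L (Ω finFT)) (η 𝕋 (⟦ finFT ⟧ 𝕏 x))
  ⟦η⟧-factors-through-Ω finF finFT 𝕏 x =
    begin
      ⟦ finF ⟧ (determinize 𝕋 L 𝕏) (η 𝕋 x)
    ≡⟨ sym (⟦⟧-preserved finF
              (fmap-isCoalgHom-determinize (⟦⟧-hom finFT 𝕏)) (η 𝕋 x)) ⟩
      ⟦ finF ⟧ (determinize 𝕋 L (Ω finFT)) (fmap TT (⟦ finFT ⟧ 𝕏) (η 𝕋 x))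
    ≡⟨ cong (⟦ finF ⟧ (determinize 𝕋 L (Ω finFT))) (sym (η-nat 𝕋 (⟦ finFT ⟧ 𝕏) x)) ⟩
      ⟦ finF ⟧ (determinize 𝕋 L (Ω finFT)) (η 𝕋 (⟦ finFT ⟧ 𝕏 x))
    ∎
    where open ≡-Reasoning

theorem1 : (𝕋 : Monad) (F : Functor) (finF : FinalCoalgebra F)
           (L : Lifting 𝕋 F) (finFT : FinalCoalgebra (F ⊚ T 𝕋))
           (𝕏 𝕐 : Coalgebra (F ⊚ T 𝕋)) (x : State 𝕏) (y : State 𝕐) →
           Beh finFT 𝕏 𝕐 x y → BehT 𝕋 L finF 𝕏 𝕐 x y
theorem1 𝕋 F finF L finFT 𝕏 𝕐 x y x∼y =
  begin
    ⟦ finF ⟧ (determinize 𝕋 L 𝕏) (η 𝕋 x)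
  ≡⟨ ⟦η⟧-factors-through-Ω 𝕋 L finF finFT 𝕏 x ⟩
    ⟦ finF ⟧ (determinize 𝕋 L (Ω finFT)) (η 𝕋 (⟦ finFT ⟧ 𝕏 x))
  ≡⟨ cong (⟦ finF ⟧ (determinize 𝕋 L (Ω finFT)) ∘ η 𝕋) x∼y ⟩
    ⟦ finF ⟧ (determinize 𝕋 L (Ω finFT)) (η 𝕋 (⟦ finFT ⟧ 𝕐 y))
  ≡⟨ sym (⟦η⟧-factors-through-Ω 𝕋 L finF finFT 𝕐 y) ⟩
    ⟦ finF ⟧ (determinize 𝕋 L 𝕐) (η 𝕋 y)
  ∎
  where open ≡-Reasoning
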